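{- Let $M$ be a finite geometric semilattice with cone $cM$ and closure operator $c\ell$ as in the context. For every $S\in cM$ and every $a\in (A\cup\{a_0\})\setminus S$, $c\ell(S\cup\{a\})$ covers $S$ in $cM$.
   Context: Geometric semilattice: ranked meet semilattice $M$ such that (a) every principal order ideal is a geometric lattice (finite semimodular atomistic ranked lattice), and (b) if $S$ is a set of atoms with $\bigvee S$ existing and $\operatorname{rank}(\bigvee S)=|S|$, and $\operatorname{rank}(t)<\operatorname{rank}(\bigvee S)$, then some $a\in S$ has $a\not\le t$ and $t\vee a$ exists. $A$ is the atom set of $M$, $a_0$ a new symbol. For $s\in M$: $A_s=\{a\in A:a\le s\}$, $P_s=\{a\in A:a,s\text{ have no common upper bound}\}$, $\underline{A_s}=A_s\cup P_s\cup\{a_0\}$; $cM=\{A_s\}\cup\{\underline{A_s}\}$ ordered by inclusion. $J(S)$ ($S\subseteq A$) is the set of existing joins $\bigvee T$, $T\subseteq S$. $c\ell(S)=A_{\bigvee S}$ if $a_0\notin S$ and $\bigvee S$ exists, else $\underline{A_t}$ for $t$ maximal in $J(S\setminus\{a_0\})$. $Y$ covers $X$ means $X\subsetneq Y$ and no element of $cM$ lies strictly between them. -}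

module Defs where

open import Level using (0ℓ)
open import Data.Nat using (ℕ; suc; _<_)
open import Data.Maybe using (Maybe; just; nothing)
open import Data.Unit using (⊤)
open import Data.Empty using (⊥)
open import Data.Product using (Σ; ∃; _×_; _,_)
open import Data.Sum using (_⊎_)
open import Data.List using (List; length)
open import Data.List.Membership.Propositional using (_∈_)
open import Data.List.Relation.Unary.All using (All)
open import Data.List.Relation.Unary.Unique.Propositional using (Unique)
open import Relation.Nullary using (¬_; Dec)
open import Relation.Binary using (IsPartialOrder)
open import Relation.Binary.PropositionalEquality using (_≡_)

record FiniteRankedMeetSemilattice : Set₁ where
  infix 4 _≤_ _≤?_ _≟_
  infixr 7 _∧_
  field
    Carrier        : Set
    _≤_            : Carrier → Carrier → Set
    isPartialOrder : IsPartialOrder _≡_ _≤_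
    _≤?_           : (x y : Carrier) → Dec (x ≤ y)
    _≟_            : (x y : Carrier) → Dec (x ≡ y)
    elems          : List Carrier
    complete       : ∀ x → x ∈ elems
    _∧_            : Carrier → Carrier → Carrier
    ∧-lowerˡ       : ∀ x y → x ∧ y ≤ x
    ∧-lowerʳ       : ∀ x y → x ∧ y ≤ y
    ∧-greatest     : ∀ x y z → z ≤ x → z ≤ y → z ≤ x ∧ y
    0̂              : Carrier
    0̂-least        : ∀ x → 0̂ ≤ x

  _⊏_ : Carrier → Carrier → Set
  x ⊏ y = x ≤ y × ¬ (x ≡ y)

  _⋖_ : Carrier → Carrier → Set
  x ⋖ y = x ⊏ y × (∀ z → x ⊏ z → ¬ (z ⊏ y))

  field
    rank       : Carrier → ℕ
    rank-0̂     : rank 0̂ ≡ 0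
    rank-cover : ∀ x y → x ⋖ y → rank y ≡ suc (rank x)

module Notions (M : FiniteRankedMeetSemilattice) where
  open FiniteRankedMeetSemilattice M

  IsAtom : Carrier → Set
  IsAtom a = 0̂ ⋖ a

  IsJoin : (Carrier → Set) → Carrier → Set
  IsJoin P j = (∀ b → P b → b ≤ j) × (∀ u → (∀ b → P b → b ≤ u) → j ≤ u)

  HasUpperBound : Carrier → Carrier → Set
  HasUpperBound x y = ∃ λ u → x ≤ u × y ≤ u

-- Every principal ideal [0̂,s] is a finite lattice
-- (finite meet semilattice, bounded above) and is ranked by the restriction
-- of `rank`; the remaining conditions of (a) are atomisticity and
-- (upper) semimodularity inside each [0̂,s]; (b) is the augmentation axiom.

record IsGeometricSemilattice (M : FiniteRankedMeetSemilattice) : Set where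
  open FiniteRankedMeetSemilattice M
  open Notions M
  field
    atomistic    : ∀ s x → x ≤ s → IsJoin (λ a → IsAtom a × a ≤ x) x
    semimodular  : ∀ s x y → x ≤ s → y ≤ s → ∀ j →
                   IsJoin (λ b → b ≡ x ⊎ b ≡ y) j →
                   (x ∧ y) ⋖ x → y ⋖ j
    augmentation : ∀ (S : List Carrier) → Unique S → All IsAtom S →
                   ∀ j → IsJoin (λ b → b ∈ S) j → rank j ≡ length S →
                   ∀ t → rank t < rank j →
                   ∃ λ a → a ∈ S × ¬ (a ≤ t) ×
                     (∃ λ k → IsJoin (λ b → b ≡ t ⊎ b ≡ a) k)

-- The cone cM and the closure operator cℓ.
-- The ground set A ∪ {a₀} is modelled inside `Maybe Carrier`:
-- `nothing` is a₀, `just a` (with a an atom) is the atom a.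

module Cone (M : FiniteRankedMeetSemilattice) where
  open FiniteRankedMeetSemilattice M
  open Notions M

  Ground : Set
  Ground = Maybe Carrier

  InGround : Ground → Set
  InGround nothing  = ⊤
  InGround (just a) = IsAtom a

  Subset : Set₁
  Subset = Ground → Set

  _⊆_ : Subset → Subset → Set
  X ⊆ Y = ∀ x → X x → Y x

  _≐_ : Subset → Subset → Set
  X ≐ Y = X ⊆ Y × Y ⊆ X

  _⊊_ : Subset → Subset → Set
  X ⊊ Y = X ⊆ Y × ¬ (X ≐ Y)

  _∪｛_｝ : Subset → Ground → Subset
  (X ∪｛ a ｝) x = X x ⊎ x ≡ a

  A_ : Carrier → Subset
  A_ s nothing  = ⊥
  A_ s (just a) = IsAtom a × a ≤ s

  Ā_ : Carrier → Subset
  Ā_ s nothing  = ⊤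
  Ā_ s (just a) = IsAtom a × (a ≤ s ⊎ ¬ HasUpperBound a s)

  InCM : Subset → Set
  InCM X = ∃ λ s → (X ≐ A_ s) ⊎ (X ≐ Ā_ s)

  Covers : Subset → Subset → Set₁
  Covers X Y = X ⊊ Y × (∀ Z → InCM Z → X ⊊ Z → ¬ (Z ⊊ Y))

  atomsOf : Subset → Carrier → Set
  atomsOf S b = S (just b)

  InJ : Subset → Carrier → Set
  InJ S t = ∃ λ (T : List Carrier) → All (atomsOf S) T × IsJoin (λ b → b ∈ T) t

  MaximalInJ : Subset → Carrier → Set
  MaximalInJ S t = InJ S t × (∀ u → InJ S u → t ≤ u → u ≡ t)

  IsClosure : Subset → Subset → Set
  IsClosure S X =
      (¬ S nothing × ∃ λ j → IsJoin (atomsOf S) j × X ≐ A_ j)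
    ⊎ ((S nothing ⊎ ¬ (∃ λ j → IsJoin (atomsOf S) j)) ×
       ∃ λ t → MaximalInJ S t × X ≐ Ā_ t)

-- Grade cM by r(A s) = rank s and r(Ā s) = rank s + 1. The key estimate is that a
-- finite set of atoms lying in Ā w (each atom below w or without a common upper bound
-- with w) has a join of rank at most rank w: otherwise augmentation, applied to a basis
-- of that join, produces an atom a ≰ w for which w ∨ a exists. It makes r strictly
-- monotone on cM, so Y covers X as soon as X ⊊ Y and r Y ≤ r X + 1. In each case the
-- closure contains S ∪ {a}, because maximality of t in J forces every atom of S ∪ {a}
-- into Ā t, and its grade is bounded either by the same estimate or by semimodularity,
-- which gives rank (b ∨ s) = rank s + 1 for an atom b ≰ s.
module Submission where

open import Defs
open import Level using (0ℓ)
open import Function using (id; _∘_; _$_)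
open import Data.Empty using (⊥-elim)
open import Data.List using (List; []; _∷_; length; filter; foldr)
open import Data.List.Membership.Propositional using (_∈_)
open import Data.List.Membership.Propositional.Properties using (∈-filter⁺; ∈-filter⁻)
open import Data.List.Relation.Binary.Subset.Propositional renaming (_⊆_ to _⊆ˡ_)
open import Data.List.Relation.Unary.All as All using (All; []; _∷_)
open import Data.List.Relation.Unary.Any as Any using (here; there)
open import Data.List.Relation.Unary.AllPairs using ([]; _∷_)
open import Data.List.Relation.Unary.Unique.Propositional using (Unique)
open import Data.Maybe using (just; nothing)
import Data.Nat as ℕ
import Data.Nat.Properties as ℕ
open import Data.Product using (∃; _×_; Σ; _,_; proj₁; proj₂; swap)
open import Data.Sum using (_⊎_; inj₁; inj₂; [_,_])
open import Data.Unit using (tt)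
open import Relation.Binary using (IsPartialOrder)
open import Relation.Binary.PropositionalEquality using (_≡_; refl; sym; trans; cong; subst)
open import Relation.Nullary using (¬_; Dec; yes; no)
open import Relation.Nullary.Decidable using (_×-dec_; _⊎-dec_; _→-dec_; ¬?; map′; decidable-stable)
open import Relation.Unary using (Pred; Decidable)

module Semilattice (M : FiniteRankedMeetSemilattice) where
  open FiniteRankedMeetSemilattice M
  open Notions M
  open Cone M
  open IsPartialOrder isPartialOrder public using (antisym) renaming (refl to ≤-refl; trans to ≤-trans)

  private variable
    c t u w x y : Carrier
    P : Pred Carrier 0ℓ
    T : List Carrier

  any? : Decidable P → Dec (∃ P)
  any? P? = map′ Any.satisfied (λ (x , px) → Any.map (λ { refl → px }) (complete x)) (Any.any? P? elems)

  all? : Decidable P → Dec (∀ x → P x)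
  all? P? = map′ (λ ps x → All.lookup ps (complete x)) (λ ps → All.tabulate (λ {x} _ → ps x)) (All.all? P? elems)

  _⊏?_ : ∀ x y → Dec (x ⊏ y)
  x ⊏? y = x ≤? y ×-dec ¬? (x ≟ y)

  atom? : ∀ a → Dec (IsAtom a)
  atom? a = 0̂ ⊏? a ×-dec all? (λ z → 0̂ ⊏? z →-dec ¬? (z ⊏? a))

  compatible? : ∀ x y → Dec (HasUpperBound x y)
  compatible? x y = any? λ u → x ≤? u ×-dec y ≤? u

  UpperBound : Pred Carrier 0ℓ → Pred Carrier 0ℓ
  UpperBound P u = ∀ b → P b → b ≤ u

  upperBound? : Decidable P → Decidable (UpperBound P)
  upperBound? P? u = all? λ b → P? b →-dec b ≤? u

  ⋀ : Carrier → List Carrier → Carrier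
  ⋀ = foldr _∧_

  ⋀-lower : ∀ u {x xs} → x ∈ xs → ⋀ u xs ≤ x
  ⋀-lower u {xs = y ∷ ys} (here refl) = ∧-lowerˡ y (⋀ u ys)
  ⋀-lower u {xs = y ∷ ys} (there x∈ys) = ≤-trans (∧-lowerʳ y (⋀ u ys)) (⋀-lower u x∈ys)

  ⋀-greatest : ∀ {z u} xs → z ≤ u → All (z ≤_) xs → z ≤ ⋀ u xs
  ⋀-greatest [] z≤u [] = z≤u
  ⋀-greatest (y ∷ ys) z≤u (z≤y ∷ z≤ys) = ∧-greatest y _ _ z≤y (⋀-greatest ys z≤u z≤ys)

  join-exists : Decidable P → ∃ (UpperBound P) → ∃ (IsJoin P)
  join-exists {P} P? (u , u-ub) = ⋀ u bounds , upper , least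
    where
    bounds : List Carrier
    bounds = filter (upperBound? P?) elems

    upper : UpperBound P (⋀ u bounds)
    upper b Pb = ⋀-greatest bounds (u-ub b Pb)
      (All.tabulate λ v∈bounds → proj₂ (∈-filter⁻ (upperBound? P?) {xs = elems} v∈bounds) b Pb)

    least : ∀ v → UpperBound P v → ⋀ u bounds ≤ v
    least v v-ub = ⋀-lower u (∈-filter⁺ (upperBound? P?) (complete v) v-ub)

  join-cong : ∀ {Q j} → (∀ u → UpperBound P u → UpperBound Q u) → (∀ u → UpperBound Q u → UpperBound P u) →
              IsJoin P j → IsJoin Q j
  join-cong P⇒Q Q⇒P (upper , least) = P⇒Q _ upper , λ u → least u ∘ Q⇒P u

  Pair : Carrier → Carrier → Pred Carrier 0ℓ
  Pair x y b = b ≡ x ⊎ b ≡ y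

  pair-ub : x ≤ u → y ≤ u → UpperBound (Pair x y) u
  pair-ub x≤u y≤u _ (inj₁ refl) = x≤u
  pair-ub x≤u y≤u _ (inj₂ refl) = y≤u

  pair-ub⁻ : UpperBound (Pair x y) u → x ≤ u × y ≤ u
  pair-ub⁻ u-ub = u-ub _ (inj₁ refl) , u-ub _ (inj₂ refl)

  join₂-exists : HasUpperBound x y → ∃ (IsJoin (Pair x y))
  join₂-exists {x} {y} (u , x≤u , y≤u) = join-exists (λ b → b ≟ x ⊎-dec b ≟ y) (u , pair-ub x≤u y≤u)

  pair⇒∷-ub : IsJoin (_∈ T) t → UpperBound (Pair c t) u → UpperBound (_∈ c ∷ T) u
  pair⇒∷-ub _ u-ub _ (here refl) = proj₁ (pair-ub⁻ u-ub)
  pair⇒∷-ub (t-ub , _) u-ub b (there b∈T) = ≤-trans (t-ub b b∈T) (proj₂ (pair-ub⁻ u-ub))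

  ∷⇒pair-ub : IsJoin (_∈ T) t → UpperBound (_∈ c ∷ T) u → UpperBound (Pair c t) u
  ∷⇒pair-ub (_ , t-least) u-ub = pair-ub (u-ub _ (here refl)) (t-least _ λ b → u-ub b ∘ there)

  join-∷⁺ : IsJoin (_∈ T) t → IsJoin (Pair c t) u → IsJoin (_∈ c ∷ T) u
  join-∷⁺ J = join-cong (λ _ → pair⇒∷-ub J) (λ _ → ∷⇒pair-ub J)

  join-∷⁻ : IsJoin (_∈ T) t → IsJoin (_∈ c ∷ T) u → IsJoin (Pair c t) u
  join-∷⁻ J = join-cong (λ _ → ∷⇒pair-ub J) (λ _ → pair⇒∷-ub J)

  atom-∧-≡0̂ : IsAtom c → ¬ c ≤ y → c ∧ y ≡ 0̂
  atom-∧-≡0̂ {c} {y} (_ , nothing-between) c≰y with c ∧ y ≟ 0̂ | c ∧ y ≟ c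
  ... | yes c∧y≡0̂ | _ = c∧y≡0̂
  ... | no _ | yes c∧y≡c = ⊥-elim (c≰y (subst (_≤ y) c∧y≡c (∧-lowerʳ c y)))
  ... | no c∧y≢0̂ | no c∧y≢c =
    ⊥-elim (nothing-between (c ∧ y) (0̂-least _ , c∧y≢0̂ ∘ sym) (∧-lowerˡ c y , c∧y≢c))

  ⊆-trans : ∀ {X Y Z} → X ⊆ Y → Y ⊆ Z → X ⊆ Z
  ⊆-trans X⊆Y Y⊆Z x = Y⊆Z x ∘ X⊆Y x

  ⊆-resp-≐ : ∀ {X X′ Y Y′} → X ≐ X′ → Y ≐ Y′ → X ⊆ Y → X′ ⊆ Y′
  ⊆-resp-≐ X≐X′ Y≐Y′ X⊆Y = ⊆-trans (proj₂ X≐X′) (⊆-trans X⊆Y (proj₁ Y≐Y′))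

  ≐-refl : ∀ {X} → X ≐ X
  ≐-refl = (λ _ → id) , (λ _ → id)

  A⊆Ā : A_ u ⊆ Ā_ u
  A⊆Ā (just x) (x-atom , x≤u) = x-atom , inj₁ x≤u

  Ā-mono : u ≤ w → Ā_ u ⊆ Ā_ w
  Ā-mono u≤w nothing _ = tt
  Ā-mono u≤w (just x) (x-atom , inj₁ x≤u) = x-atom , inj₁ (≤-trans x≤u u≤w)
  Ā-mono u≤w (just x) (x-atom , inj₂ x-incompatible) =
    x-atom , inj₂ λ (v , x≤v , w≤v) → x-incompatible (v , x≤v , ≤-trans u≤w w≤v)

  Ā-compatible⇒≤ : Ā_ u (just x) → HasUpperBound x u → x ≤ u
  Ā-compatible⇒≤ (_ , inj₁ x≤u) _ = x≤u
  Ā-compatible⇒≤ (_ , inj₂ x-incompatible) x-compatible = ⊥-elim (x-incompatible x-compatible)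

module Geometric (M : FiniteRankedMeetSemilattice) (G : IsGeometricSemilattice M) where
  open FiniteRankedMeetSemilattice M
  open Notions M
  open IsGeometricSemilattice G
  open Cone M
  open Semilattice M
  open import Data.List.Membership.DecPropositional _≟_ using (_∈?_)

  private variable
    a c j t u v w y : Carrier
    T : List Carrier

  atomistic-≤ : (∀ x → IsAtom x → x ≤ u → x ≤ v) → u ≤ v
  atomistic-≤ {u} {v} below = proj₂ (atomistic u u ≤-refl) v λ x (x-atom , x≤u) → below x x-atom x≤u

  atomsBelow : Carrier → List Carrier
  atomsBelow u = filter (λ a → atom? a ×-dec a ≤? u) elems

  ∈-atomsBelow⁻ : a ∈ atomsBelow u → A_ u (just a)
  ∈-atomsBelow⁻ {u = u} = proj₂ ∘ ∈-filter⁻ (λ a → atom? a ×-dec a ≤? u) {xs = elems}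

  atomsBelow-⊆ : ∀ {X} → A_ u ⊆ X → All (λ a → X (just a)) (atomsBelow u)
  atomsBelow-⊆ A⊆X = All.tabulate λ a∈ → A⊆X (just _) (∈-atomsBelow⁻ a∈)

  atomsBelow-join : IsJoin (_∈ atomsBelow u) u
  atomsBelow-join {u} = (λ _ → proj₂ ∘ ∈-atomsBelow⁻) , λ v v-ub → atomistic-≤ λ x x-atom x≤u →
    v-ub x (∈-filter⁺ (λ a → atom? a ×-dec a ≤? u) (complete x) (x-atom , x≤u))

  rank-join-atom : IsAtom c → ¬ c ≤ y → IsJoin (Pair c y) j → rank j ≡ ℕ.suc (rank y)
  rank-join-atom {c} {y} {j} c-atom c≰y J = rank-cover y j
    (semimodular j c y c≤j y≤j j J (subst (_⋖ c) (sym (atom-∧-≡0̂ c-atom c≰y)) c-atom))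
    where
    c≤j : c ≤ j
    c≤j = proj₁ (pair-ub⁻ (proj₁ J))

    y≤j : y ≤ j
    y≤j = proj₂ (pair-ub⁻ (proj₁ J))

  record Basis (u : Carrier) : Set where
    field
      atoms       : List Carrier
      unique      : Unique atoms
      all-atoms   : All IsAtom atoms
      join        : IsJoin (_∈ atoms) u
      rank≡length : rank u ≡ length atoms

  SubBasis : List Carrier → Carrier → Set
  SubBasis T u = Σ (Basis u) λ β → Basis.atoms β ⊆ˡ T

  subBasis : ∀ T → All IsAtom T → IsJoin (_∈ T) j → SubBasis T j
  subBasis {j} [] [] J = record { atoms = [] ; unique = [] ; all-atoms = [] ; join = J ; rank≡length = rank≡0 } , λ ()
    where
    rank≡0 : rank j ≡ 0
    rank≡0 = trans (cong rank (antisym (proj₂ J 0̂ λ _ ()) (0̂-least _))) rank-0̂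
  subBasis {j} (c ∷ T) (c-atom ∷ T-atoms) J
    with join-exists (_∈? T) (_ , λ b → proj₁ J b ∘ there)
  ... | t , Jt with subBasis T T-atoms Jt | c ≤? t
  ... | β , β⊆T | yes c≤t = subst (SubBasis (c ∷ T)) t≡j (β , there ∘ β⊆T)
    where
    J₂ : IsJoin (Pair c t) j
    J₂ = join-∷⁻ Jt J

    t≡j : t ≡ j
    t≡j = antisym (proj₂ (pair-ub⁻ (proj₁ J₂))) (proj₂ J₂ t (pair-ub c≤t ≤-refl))
  ... | β , β⊆T | no c≰t = record
      { atoms       = c ∷ atoms
      ; unique      = All.tabulate (λ { b∈β refl → c≰t (proj₁ join _ b∈β) }) ∷ unique
      ; all-atoms   = c-atom ∷ all-atoms
      ; join        = join-∷⁺ join J₂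
      ; rank≡length = trans (rank-join-atom c-atom c≰t J₂) (cong ℕ.suc rank≡length)
      } , λ { (here refl) → here refl ; (there b∈β) → there (β⊆T b∈β) }
    where
    open Basis β

    J₂ : IsJoin (Pair c t) j
    J₂ = join-∷⁻ Jt J

  rank-join≤ : All (λ x → Ā_ w (just x)) T → IsJoin (_∈ T) t → rank t ℕ.≤ rank w
  rank-join≤ {w} {T} {t} T⊆Āw J = ℕ.≮⇒≥ λ w<t →
    let β , β⊆T = subBasis T (All.map proj₁ T⊆Āw) J
        open Basis β
        a , a∈β , a≰w , k , K = augmentation atoms unique all-atoms t join rank≡length w w<t
        w≤k , a≤k = pair-ub⁻ (proj₁ K)
    in a≰w (Ā-compatible⇒≤ (All.lookup T⊆Āw (β⊆T a∈β)) (k , a≤k , w≤k))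

  A⊆Ā⇒rank≤ : A_ u ⊆ Ā_ w → rank u ℕ.≤ rank w
  A⊆Ā⇒rank≤ A⊆Ā = rank-join≤ (atomsBelow-⊆ A⊆Ā) atomsBelow-join

  A⊆Ā⇒rank< : ∀ {d} → A_ u ⊆ Ā_ w → Ā_ w (just d) → ¬ d ≤ u → HasUpperBound d u → rank u ℕ.< rank w
  A⊆Ā⇒rank< {w = w} A⊆Ā d∈Āw d≰u d-compatible =
    let j , J = join₂-exists d-compatible
    in subst (ℕ._≤ rank w) (rank-join-atom (proj₁ d∈Āw) d≰u J)
         (rank-join≤ (d∈Āw ∷ atomsBelow-⊆ A⊆Ā) (join-∷⁺ atomsBelow-join J))

  Ā-⊆-of-rank≤ : A_ u ⊆ Ā_ w → rank w ℕ.≤ rank u → Ā_ w ⊆ Ā_ u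
  Ā-⊆-of-rank≤ A⊆Ā w≤u nothing _ = tt
  Ā-⊆-of-rank≤ {u} A⊆Ā w≤u (just d) d∈Āw with d ≤? u | compatible? d u
  ... | yes d≤u | _ = proj₁ d∈Āw , inj₁ d≤u
  ... | no _ | no d-incompatible = proj₁ d∈Āw , inj₂ d-incompatible
  ... | no d≰u | yes d-compatible = ⊥-elim (ℕ.<⇒≱ (A⊆Ā⇒rank< A⊆Ā d∈Āw d≰u d-compatible) w≤u)

  A-⊆-of-rank≤ : A_ u ⊆ A_ v → rank v ℕ.≤ rank u → A_ v ⊆ A_ u
  A-⊆-of-rank≤ {u} {v} Au⊆Av v≤u (just d) d∈Av@(d-atom , d≤v) = d-atom ,
    Ā-compatible⇒≤ (Ā-⊆-of-rank≤ (⊆-trans Au⊆Av A⊆Ā) v≤u (just d) (A⊆Ā (just d) d∈Av)) (v , d≤v , u≤v)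
    where
    u≤v : u ≤ v
    u≤v = atomistic-≤ λ x x-atom x≤u → proj₂ (Au⊆Av (just x) (x-atom , x≤u))

module ConeRank (M : FiniteRankedMeetSemilattice) (G : IsGeometricSemilattice M) where
  open FiniteRankedMeetSemilattice M
  open Cone M
  open Semilattice M
  open Geometric M G

  private variable
    X Y : Subset

  coneRank : InCM X → ℕ.ℕ
  coneRank (s , inj₁ _) = rank s
  coneRank (s , inj₂ _) = ℕ.suc (rank s)

  ⊆-of-coneRank≥ : (p : InCM X) (q : InCM Y) → X ⊆ Y → coneRank q ℕ.≤ coneRank p → Y ⊆ X
  ⊆-of-coneRank≥ (u , inj₁ X≐Au) (v , inj₁ Y≐Av) X⊆Y v≤u =
    ⊆-resp-≐ (swap Y≐Av) (swap X≐Au) (A-⊆-of-rank≤ (⊆-resp-≐ X≐Au Y≐Av X⊆Y) v≤u)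
  ⊆-of-coneRank≥ (u , inj₁ X≐Au) (v , inj₂ Y≐Āv) X⊆Y v<u =
    ⊥-elim (ℕ.<⇒≱ v<u (A⊆Ā⇒rank≤ (⊆-resp-≐ X≐Au Y≐Āv X⊆Y)))
  ⊆-of-coneRank≥ (u , inj₂ X≐Āu) (v , inj₁ Y≐Av) X⊆Y _ =
    ⊥-elim (proj₁ Y≐Av nothing (X⊆Y nothing (proj₂ X≐Āu nothing tt)))
  ⊆-of-coneRank≥ (u , inj₂ X≐Āu) (v , inj₂ Y≐Āv) X⊆Y (ℕ.s≤s v≤u) =
    ⊆-resp-≐ (swap Y≐Āv) (swap X≐Āu) (Ā-⊆-of-rank≤ (⊆-trans A⊆Ā (⊆-resp-≐ X≐Āu Y≐Āv X⊆Y)) v≤u)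

  coneRank-mono : (p : InCM X) (q : InCM Y) → X ⊊ Y → coneRank p ℕ.< coneRank q
  coneRank-mono p q (X⊆Y , X≭Y) = ℕ.≰⇒> λ q≤p → X≭Y (X⊆Y , ⊆-of-coneRank≥ p q X⊆Y q≤p)

  covers-of-coneRank≤ : (p : InCM X) (q : InCM Y) → X ⊊ Y → coneRank q ℕ.≤ ℕ.suc (coneRank p) → Covers X Y
  covers-of-coneRank≤ p q X⊊Y q≤1+p = X⊊Y , λ Z r X⊊Z Z⊊Y →
    ℕ.<⇒≱ (coneRank-mono p r X⊊Z) (ℕ.s≤s⁻¹ (ℕ.≤-trans (coneRank-mono r q Z⊊Y) q≤1+p))

module Closure (M : FiniteRankedMeetSemilattice) (G : IsGeometricSemilattice M) where
  open FiniteRankedMeetSemilattice M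
  open Notions M
  open Cone M
  open Semilattice M
  open Geometric M G
  open ConeRank M G

  private variable
    b j k s t w : Carrier
    S X : Subset
    a : Ground

  ClosureCovers : Subset → Ground → Set₁
  ClosureCovers S a = (∃ λ X → IsClosure (S ∪｛ a ｝) X) × (∀ X → IsClosure (S ∪｛ a ｝) X → Covers S X)

  ∪-⊆ : S ⊆ X → X a → (S ∪｛ a ｝) ⊆ X
  ∪-⊆ S⊆X a∈X x (inj₁ x∈S) = S⊆X x x∈S
  ∪-⊆ S⊆X a∈X x (inj₂ refl) = a∈X

  ⊆-∪ : S ⊆ (S ∪｛ a ｝)
  ⊆-∪ _ = inj₁

  ∪-⊊ : ¬ S a → (S ∪｛ a ｝) ⊆ X → S ⊊ X
  ∪-⊊ a∉S S′⊆X = (⊆-trans ⊆-∪ S′⊆X) , λ (_ , X⊆S) → a∉S (X⊆S _ (S′⊆X _ (inj₂ refl)))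

  A⊆⇒InJ : A_ w ⊆ S → InJ S w
  A⊆⇒InJ A⊆S = atomsBelow _ , atomsBelow-⊆ A⊆S , atomsBelow-join

  InJ-extend : InJ S t → S (just b) → IsJoin (Pair b t) k → InJ S k
  InJ-extend (T , T⊆S , J) b∈S K = _ ∷ T , b∈S ∷ T⊆S , join-∷⁺ J K

  InJ-rank≤ : InJ S t → S ⊆ Ā_ w → rank t ℕ.≤ rank w
  InJ-rank≤ (T , T⊆S , J) S⊆Āw = rank-join≤ (All.map (S⊆Āw (just _)) T⊆S) J

  ⊆Ā⇒maximal : InJ S t → S ⊆ Ā_ t → MaximalInJ S t
  ⊆Ā⇒maximal {t = t} t∈J S⊆Āt = t∈J , λ u (T , T⊆S , J) t≤u →
    antisym (proj₂ J t λ b b∈T → Ā-compatible⇒≤ (S⊆Āt (just b) (All.lookup T⊆S b∈T)) (u , proj₁ J b b∈T , t≤u)) t≤u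

  maximal⇒⊆Ā : (∀ c → S (just c) → IsAtom c) → MaximalInJ S t → S ⊆ Ā_ t
  maximal⇒⊆Ā atoms _ nothing _ = tt
  maximal⇒⊆Ā {S} {t} atoms (t∈J , maximal) (just c) c∈S with c ≤? t | compatible? c t
  ... | yes c≤t | _ = atoms c c∈S , inj₁ c≤t
  ... | no _ | no c-incompatible = atoms c c∈S , inj₂ c-incompatible
  ... | no c≰t | yes c-compatible =
    let k , K = join₂-exists c-compatible
        c≤k , t≤k = pair-ub⁻ (proj₁ K)
    in ⊥-elim (c≰t (subst (c ≤_) (maximal k (InJ-extend {S} t∈J c∈S K) t≤k) c≤k))

  Ā-closure-covers : (p : InCM S) → ¬ S a → InJ (S ∪｛ a ｝) w → (S ∪｛ a ｝) ⊆ Ā_ w → rank w ℕ.≤ coneRank p →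
                     (S ∪｛ a ｝) nothing ⊎ ¬ ∃ (IsJoin (atomsOf (S ∪｛ a ｝))) → ClosureCovers S a
  Ā-closure-covers {S} {a} p a∉S w∈J S′⊆Āw w≤p no-join-closure =
    (_ , inj₂ (no-join-closure , _ , ⊆Ā⇒maximal w∈J S′⊆Āw , ≐-refl)) , covers
    where
    covers : ∀ X → IsClosure (S ∪｛ a ｝) X → Covers S X
    covers X (inj₁ (a₀∉S′ , j , J , _)) = ⊥-elim ([ a₀∉S′ , _$ (j , J) ] no-join-closure)
    covers X (inj₂ (_ , t , t-max , X≐Āt)) =
      covers-of-coneRank≤ p (t , inj₂ X≐Āt) (∪-⊊ a∉S S′⊆X) (ℕ.s≤s (ℕ.≤-trans (InJ-rank≤ (proj₁ t-max) S′⊆Āw) w≤p))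
      where
      S′⊆X : (S ∪｛ a ｝) ⊆ X
      S′⊆X = ⊆-trans (maximal⇒⊆Ā (λ c → proj₁ ∘ S′⊆Āw (just c)) t-max) (proj₂ X≐Āt)

  A∪-ub⁺ : S ≐ A_ s → ∀ {u} → UpperBound (Pair b s) u → UpperBound (atomsOf (S ∪｛ just b ｝)) u
  A∪-ub⁺ S≐As u-ub c (inj₁ c∈S) = ≤-trans (proj₂ (proj₁ S≐As (just c) c∈S)) (proj₂ (pair-ub⁻ u-ub))
  A∪-ub⁺ S≐As u-ub c (inj₂ refl) = proj₁ (pair-ub⁻ u-ub)

  A∪-ub⁻ : S ≐ A_ s → ∀ {u} → UpperBound (atomsOf (S ∪｛ just b ｝)) u → UpperBound (Pair b s) u
  A∪-ub⁻ S≐As u-ub = pair-ub (u-ub _ (inj₂ refl))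
    (atomistic-≤ λ x x-atom x≤s → u-ub x (inj₁ (proj₂ S≐As (just x) (x-atom , x≤s))))

  A∪-join⁺ : S ≐ A_ s → IsJoin (Pair b s) j → IsJoin (atomsOf (S ∪｛ just b ｝)) j
  A∪-join⁺ S≐As = join-cong (λ _ → A∪-ub⁺ S≐As) (λ _ → A∪-ub⁻ S≐As)

  A∪-join⁻ : S ≐ A_ s → IsJoin (atomsOf (S ∪｛ just b ｝)) j → IsJoin (Pair b s) j
  A∪-join⁻ S≐As = join-cong (λ _ → A∪-ub⁻ S≐As) (λ _ → A∪-ub⁺ S≐As)

  A∪a₀ : S ≐ A_ s → ClosureCovers S nothing
  A∪a₀ {S} {s} S≐As = Ā-closure-covers (s , inj₁ S≐As) (proj₁ S≐As nothing)
    (A⊆⇒InJ (⊆-trans (proj₂ S≐As) ⊆-∪)) (∪-⊆ (⊆-trans (proj₁ S≐As) A⊆Ā) tt) ℕ.≤-refl (inj₁ (inj₂ refl))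

  A∪incompatible : S ≐ A_ s → IsAtom b → ¬ HasUpperBound b s → ClosureCovers S (just b)
  A∪incompatible {S} {s} {b} S≐As b-atom b-incompatible = Ā-closure-covers (s , inj₁ S≐As) b∉S
    (A⊆⇒InJ (⊆-trans (proj₂ S≐As) ⊆-∪)) (∪-⊆ (⊆-trans (proj₁ S≐As) A⊆Ā) (b-atom , inj₂ b-incompatible))
    ℕ.≤-refl (inj₂ λ (j , J) → b-incompatible (j , pair-ub⁻ (proj₁ (A∪-join⁻ S≐As J))))
    where
    b∉S : ¬ S (just b)
    b∉S b∈S = b-incompatible (s , proj₂ (proj₁ S≐As (just b) b∈S) , ≤-refl)

  A∪join : S ≐ A_ s → IsAtom b → ¬ S (just b) → IsJoin (Pair b s) j → ClosureCovers S (just b)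
  A∪join {S} {s} {b} {j} S≐As b-atom b∉S J = (A_ j , inj₁ (a₀∉S′ , j , A∪-join⁺ S≐As J , ≐-refl)) , covers
    where
    a₀∉S′ : ¬ (S ∪｛ just b ｝) nothing
    a₀∉S′ = [ proj₁ S≐As nothing , (λ ()) ]

    b≰s : ¬ b ≤ s
    b≰s b≤s = b∉S (proj₂ S≐As (just b) (b-atom , b≤s))

    S′-atoms : ∀ c → (S ∪｛ just b ｝) (just c) → IsAtom c
    S′-atoms c (inj₁ c∈S) = proj₁ (proj₁ S≐As (just c) c∈S)
    S′-atoms c (inj₂ refl) = b-atom

    covers : ∀ X → IsClosure (S ∪｛ just b ｝) X → Covers S X
    covers X (inj₁ (_ , k , K , X≐Ak)) = covers-of-coneRank≤ (s , inj₁ S≐As) (k , inj₁ X≐Ak) (∪-⊊ b∉S S′⊆X)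
      (ℕ.≤-reflexive (rank-join-atom b-atom b≰s (A∪-join⁻ S≐As K)))
      where
      S′⊆X : (S ∪｛ just b ｝) ⊆ X
      S′⊆X nothing a₀∈S′ = ⊥-elim (a₀∉S′ a₀∈S′)
      S′⊆X (just c) c∈S′ = proj₂ X≐Ak (just c) (S′-atoms c c∈S′ , proj₁ K c c∈S′)
    covers X (inj₂ (no-join-closure , _)) = ⊥-elim ([ a₀∉S′ , _$ (j , A∪-join⁺ S≐As J) ] no-join-closure)

  A∪atom : S ≐ A_ s → IsAtom b → ¬ S (just b) → ClosureCovers S (just b)
  A∪atom {s = s} {b} S≐As b-atom b∉S with compatible? b s
  ... | yes b-compatible = A∪join S≐As b-atom b∉S (proj₂ (join₂-exists b-compatible))
  ... | no b-incompatible = A∪incompatible S≐As b-atom b-incompatible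

  Ā∪join : S ≐ Ā_ s → IsAtom b → ¬ S (just b) → IsJoin (Pair b s) w → ClosureCovers S (just b)
  Ā∪join {S} {s} {b} {w} S≐Ās b-atom b∉S W = Ā-closure-covers (s , inj₂ S≐Ās) b∉S w∈J S′⊆Āw
    (ℕ.≤-reflexive (rank-join-atom b-atom b≰s W)) (inj₁ (inj₁ (proj₂ S≐Ās nothing tt)))
    where
    b≰s : ¬ b ≤ s
    b≰s b≤s = b∉S (proj₂ S≐Ās (just b) (b-atom , inj₁ b≤s))

    w∈J : InJ (S ∪｛ just b ｝) w
    w∈J = InJ-extend {S ∪｛ just b ｝} (A⊆⇒InJ (⊆-trans A⊆Ā (⊆-trans (proj₂ S≐Ās) ⊆-∪))) (inj₂ refl) W

    S′⊆Āw : (S ∪｛ just b ｝) ⊆ Ā_ w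
    S′⊆Āw = ∪-⊆ (⊆-trans (proj₁ S≐Ās) (Ā-mono (proj₂ (pair-ub⁻ (proj₁ W))))) (b-atom , inj₁ (proj₁ (pair-ub⁻ (proj₁ W))))

  Ā∪atom : S ≐ Ā_ s → IsAtom b → ¬ S (just b) → ClosureCovers S (just b)
  Ā∪atom {s = s} {b} S≐Ās b-atom b∉S = Ā∪join S≐Ās b-atom b∉S (proj₂ (join₂-exists b-compatible))
    where
    b-compatible : HasUpperBound b s
    b-compatible = decidable-stable (compatible? b s) λ b-incompatible →
      b∉S (proj₂ S≐Ās (just b) (b-atom , inj₂ b-incompatible))

lemma5p6 : (M : FiniteRankedMeetSemilattice) → IsGeometricSemilattice M →
           let open Cone M in
           ∀ (S : Subset) → InCM S → ∀ (a : Ground) → InGround a → ¬ S a →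
           (∃ λ X → IsClosure (S ∪｛ a ｝) X) ×
           (∀ X → IsClosure (S ∪｛ a ｝) X → Covers S X)
lemma5p6 M G S (s , inj₁ S≐As) nothing _ _ = Closure.A∪a₀ M G S≐As
lemma5p6 M G S (s , inj₁ S≐As) (just b) b-atom b∉S = Closure.A∪atom M G S≐As b-atom b∉S
lemma5p6 M G S (s , inj₂ S≐Ās) nothing _ a₀∉S = ⊥-elim (a₀∉S (proj₂ S≐Ās nothing tt))
lemma5p6 M G S (s , inj₂ S≐Ās) (just b) b-atom b∉S = Closure.Ā∪atom M G S≐Ās b-atom b∉S
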